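{- Let $(X,R)$ be a tense Priestley space and let $Y\subseteq X$ be an upward (respectively, downward) closed subset. The following are equivalent: (i) $Y$ is a $\mathbf{tPS}$-set; (ii) for all $x\in Y$, $R(x)\subseteq Y$ and $R^{ -1}(x)\subseteq Y$; (iii) $Y=\mathbf{G}_R(Y)\cap Y\cap\mathbf{H}_{R^{ -1}}(Y)$; (iv) $Y=\mathbf{F}_R(Y)\cup Y\cup\mathbf{P}_{R^{ -1}}(Y)$.
   Context: For a relation $R$ on $X$: $R(x)=\{y:(x,y)\in R\}$, $R^{ -1}(x)=\{y:(y,x)\in R\}$, $\mathbf{G}_R(Y)=\{x:R(x)\subseteq Y\}$, $\mathbf{F}_R(Y)=\{x:R(x)\cap Y\neq\emptyset\}$, $\mathbf{H}_{R^{ -1}}(Y)=\{x:R^{ -1}(x)\subseteq Y\}$, $\mathbf{P}_{R^{ -1}}(Y)=\{x:R^{ -1}(x)\cap Y\ne\emptyset\}$. A tense Priestley space is a Priestley space $(X,\le,\tau)$ with a relation $R$ such that (tPS1) each $R(x)$ is closed; (tPS2) $R(x)={\uparrow}R(x)\cap{\downarrow}R(x)$; (tPS3) the set of clopen up-sets is closed under $\mathbf{G}_R,\mathbf{H}_{R^{ -1}},\mathbf{F}_R,\mathbf{P}_{R^{ -1}}$. A subset $Y\subseteq X$ is a $\mathbf{tPS}$-set if for all $x,y\in X$: (tc1) if $x\in R^{ -1}(y)\cap Y$ then there are $w_1,w_2\in R(x)\cap Y$ with $w_1\le y\le w_2$; (tc2) if $x\in R(y)\cap Y$ then there are $w_1,w_2\in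 R^{ -1}(x)\cap Y$ with $w_1\le y\le w_2$. -}

module Defs where

open import Level using (0ℓ)
open import Data.Product using (Σ; _×_; _,_)
open import Data.List using (List)
open import Data.List.Relation.Unary.Any using (Any)
open import Relation.Nullary using (¬_)
open import Relation.Binary using (Rel)
open import Relation.Binary.PropositionalEquality using (_≡_)
open import Relation.Binary.Structures using (IsPartialOrder)
open import Relation.Unary using (Pred; _∈_; _∉_; _⊆_; _≐_; _∩_; ∁; U; ∅)

record Topology (X : Set) : Set₁ where
  field
    Open      : Pred X 0ℓ → Set
    open-resp : ∀ {A B} → A ≐ B → Open A → Open B
    open-∅    : Open ∅
    open-U    : Open U
    open-∩    : ∀ {A B} → Open A → Open B → Open (A ∩ B)
    open-⋃    : (I : Set) (A : I → Pred X 0ℓ) → (∀ i → Open (A i)) →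
                Open (λ x → Σ I λ i → A i x)

  Closed : Pred X 0ℓ → Set
  Closed A = Open (∁ A)

  Clopen : Pred X 0ℓ → Set
  Clopen A = Open A × Closed A

  Compact : Set₁
  Compact = (I : Set) (A : I → Pred X 0ℓ) → (∀ i → Open (A i)) →
            (∀ x → Σ I λ i → A i x) →
            Σ (List I) λ is → ∀ x → Any (λ i → A i x) is

module _ {X : Set} (_≤_ : Rel X 0ℓ) where

  IsUpSet : Pred X 0ℓ → Set
  IsUpSet A = ∀ {x y} → x ≤ y → x ∈ A → y ∈ A

  IsDownSet : Pred X 0ℓ → Set
  IsDownSet A = ∀ {x y} → y ≤ x → x ∈ A → y ∈ A

  ↑ : Pred X 0ℓ → Pred X 0ℓ
  ↑ A y = Σ X λ a → a ∈ A × a ≤ y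

  ↓ : Pred X 0ℓ → Pred X 0ℓ
  ↓ A y = Σ X λ a → a ∈ A × y ≤ a

module _ {X : Set} (R : Rel X 0ℓ) where

  Img : X → Pred X 0ℓ
  Img x y = R x y

  InvImg : X → Pred X 0ℓ
  InvImg x y = R y x

  G : Pred X 0ℓ → Pred X 0ℓ
  G Y x = Img x ⊆ Y

  F : Pred X 0ℓ → Pred X 0ℓ
  F Y x = Σ X λ y → y ∈ Img x × y ∈ Y

  H : Pred X 0ℓ → Pred X 0ℓ
  H Y x = InvImg x ⊆ Y

  P : Pred X 0ℓ → Pred X 0ℓ
  P Y x = Σ X λ y → y ∈ InvImg x × y ∈ Y

record TensePriestleySpace : Set₁ where
  field
    Carrier        : Set
    _≤_            : Rel Carrier 0ℓ
    isPartialOrder : IsPartialOrder _≡_ _≤_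
    τ              : Topology Carrier
  open Topology τ public
  field
    compact        : Compact
    separation     : ∀ x y → ¬ (x ≤ y) →
                     Σ (Pred Carrier 0ℓ) λ A →
                       Clopen A × IsUpSet _≤_ A × x ∈ A × y ∉ A
    R              : Rel Carrier 0ℓ
    tPS1           : ∀ x → Closed (Img R x)
    tPS2           : ∀ x → Img R x ≐ (↑ _≤_ (Img R x) ∩ ↓ _≤_ (Img R x))
    tPS3-G         : ∀ A → Clopen A → IsUpSet _≤_ A →
                     Clopen (G R A) × IsUpSet _≤_ (G R A)
    tPS3-H         : ∀ A → Clopen A → IsUpSet _≤_ A →
                     Clopen (H R A) × IsUpSet _≤_ (H R A)
    tPS3-F         : ∀ A → Clopen A → IsUpSet _≤_ A →
                     Clopen (F R A) × IsUpSet _≤_ (F R A)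
    tPS3-P         : ∀ A → Clopen A → IsUpSet _≤_ A →
                     Clopen (P R A) × IsUpSet _≤_ (P R A)

  IsTPSSet : Pred Carrier 0ℓ → Set
  IsTPSSet Y =
    (∀ x y → x ∈ InvImg R y → x ∈ Y →
       Σ Carrier λ w₁ → Σ Carrier λ w₂ →
         w₁ ∈ Img R x × w₁ ∈ Y × w₂ ∈ Img R x × w₂ ∈ Y × w₁ ≤ y × y ≤ w₂)
    ×
    (∀ x y → x ∈ Img R y → x ∈ Y →
       Σ Carrier λ w₁ → Σ Carrier λ w₂ →
         w₁ ∈ InvImg R x × w₁ ∈ Y × w₂ ∈ InvImg R x × w₂ ∈ Y × w₁ ≤ y × y ≤ w₂)

{-# OPTIONS --safe #-}
module Submission where

open import Defs
open import Level using (0ℓ)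
open import Data.Product using (_×_; _,_)
open import Data.Sum using (_⊎_; inj₁; inj₂)
open import Function.Bundles using (_⇔_; mk⇔)
open import Function.Construct.Composition using (_⇔-∘_)
open import Relation.Binary using (Rel)
open import Relation.Binary.Structures using (IsPartialOrder)
open import Relation.Unary using (Pred; _∈_; _⊆_; _≐_; _∩_; _∪_)

-- The tPS conditions sandwich y between points of Y, so they force y ∈ Y exactly
-- when Y is order-convex; conversely y itself is always a witness (w₁ = w₂ = y).
-- Conditions (iii) and (iv) are just two reformulations of closure under R and R⁻¹.

module _ {X : Set} (_≤_ : Rel X 0ℓ) where

  IsConvex : Pred X 0ℓ → Set
  IsConvex A = ∀ {w₁ y w₂} → w₁ ∈ A → w₂ ∈ A → w₁ ≤ y → y ≤ w₂ → y ∈ A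

  upSet⇒convex : ∀ {A} → IsUpSet _≤_ A → IsConvex A
  upSet⇒convex up w₁∈A _ w₁≤y _ = up w₁≤y w₁∈A

  downSet⇒convex : ∀ {A} → IsDownSet _≤_ A → IsConvex A
  downSet⇒convex down _ w₂∈A _ y≤w₂ = down y≤w₂ w₂∈A

  upOrDownSet⇒convex : ∀ {A} → IsUpSet _≤_ A ⊎ IsDownSet _≤_ A → IsConvex A
  upOrDownSet⇒convex (inj₁ up)   = upSet⇒convex up
  upOrDownSet⇒convex (inj₂ down) = downSet⇒convex down

module _ {X : Set} (R : Rel X 0ℓ) where

  IsStable : Pred X 0ℓ → Set
  IsStable Y = ∀ x → x ∈ Y → (Img R x ⊆ Y × InvImg R x ⊆ Y)

  stable⇔≐G∩H : ∀ {Y} → IsStable Y ⇔ (Y ≐ (G R Y ∩ Y ∩ H R Y))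
  stable⇔≐G∩H {Y} = mk⇔ to from
    where
    to : IsStable Y → Y ≐ (G R Y ∩ Y ∩ H R Y)
    to stable = (λ {x} x∈Y → let (R[x]⊆Y , R⁻¹[x]⊆Y) = stable x x∈Y
                             in R[x]⊆Y , x∈Y , R⁻¹[x]⊆Y)
              , (λ (_ , x∈Y , _) → x∈Y)

    from : Y ≐ (G R Y ∩ Y ∩ H R Y) → IsStable Y
    from (Y⊆G∩H , _) x x∈Y = let (R[x]⊆Y , _ , R⁻¹[x]⊆Y) = Y⊆G∩H x∈Y
                             in R[x]⊆Y , R⁻¹[x]⊆Y

  stable⇔≐F∪P : ∀ {Y} → IsStable Y ⇔ (Y ≐ (F R Y ∪ Y ∪ P R Y))
  stable⇔≐F∪P {Y} = mk⇔ to from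
    where
    to : IsStable Y → Y ≐ (F R Y ∪ Y ∪ P R Y)
    to stable = (λ x∈Y → inj₂ (inj₁ x∈Y)) , F∪P⊆Y
      where
      F∪P⊆Y : (F R Y ∪ Y ∪ P R Y) ⊆ Y
      F∪P⊆Y (inj₁ (y , xRy , y∈Y))        = let (_ , R⁻¹[y]⊆Y) = stable y y∈Y in R⁻¹[y]⊆Y xRy
      F∪P⊆Y (inj₂ (inj₁ x∈Y))             = x∈Y
      F∪P⊆Y (inj₂ (inj₂ (y , yRx , y∈Y))) = let (R[y]⊆Y , _) = stable y y∈Y in R[y]⊆Y yRx

    from : Y ≐ (F R Y ∪ Y ∪ P R Y) → IsStable Y
    from (_ , F∪P⊆Y) x x∈Y = (λ xRy → F∪P⊆Y (inj₂ (inj₂ (x , xRy , x∈Y))))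
                           , (λ yRx → F∪P⊆Y (inj₁ (x , yRx , x∈Y)))

module _ (S : TensePriestleySpace) where

  open TensePriestleySpace S

  stable⇒tPS : ∀ {Y} → IsStable R Y → IsTPSSet Y
  stable⇒tPS stable =
      (λ x y xRy x∈Y → let (R[x]⊆Y , _) = stable x x∈Y; y∈Y = R[x]⊆Y xRy
                       in y , y , xRy , y∈Y , xRy , y∈Y , ≤-refl , ≤-refl)
    , (λ x y yRx x∈Y → let (_ , R⁻¹[x]⊆Y) = stable x x∈Y; y∈Y = R⁻¹[x]⊆Y yRx
                       in y , y , yRx , y∈Y , yRx , y∈Y , ≤-refl , ≤-refl)
    where
    ≤-refl : ∀ {a} → a ≤ a
    ≤-refl = IsPartialOrder.refl isPartialOrder

  convex∧tPS⇒stable : ∀ {Y} → IsConvex _≤_ Y → IsTPSSet Y → IsStable R Y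
  convex∧tPS⇒stable convex (tc1 , tc2) x x∈Y =
      (λ {y} xRy → let (_ , _ , _ , w₁∈Y , _ , w₂∈Y , w₁≤y , y≤w₂) = tc1 x y xRy x∈Y
                   in convex w₁∈Y w₂∈Y w₁≤y y≤w₂)
    , (λ {y} yRx → let (_ , _ , _ , w₁∈Y , _ , w₂∈Y , w₁≤y , y≤w₂) = tc2 x y yRx x∈Y
                   in convex w₁∈Y w₂∈Y w₁≤y y≤w₂)

lemma4p2 : (S : TensePriestleySpace) (Y : Pred (TensePriestleySpace.Carrier S) 0ℓ) →
    let open TensePriestleySpace S in
    (IsUpSet _≤_ Y ⊎ IsDownSet _≤_ Y) →
    let i   = IsTPSSet Y
        ii  = ∀ x → x ∈ Y → (Img R x ⊆ Y × InvImg R x ⊆ Y)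
        iii = Y ≐ (G R Y ∩ Y ∩ H R Y)
        iv  = Y ≐ (F R Y ∪ Y ∪ P R Y)
    in (i ⇔ ii) × (i ⇔ iii) × (i ⇔ iv)
lemma4p2 S Y upOrDown = tPS⇔stable , stable⇔≐G∩H R ⇔-∘ tPS⇔stable
                                   , stable⇔≐F∪P R ⇔-∘ tPS⇔stable
  where
  open TensePriestleySpace S

  tPS⇔stable : IsTPSSet Y ⇔ IsStable R Y
  tPS⇔stable = mk⇔ (convex∧tPS⇒stable S (upOrDownSet⇒convex _≤_ upOrDown))
                   (stable⇒tPS S)
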